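{- Let $\mathfrak{M}$ be a computable graph machine with underlying computable graph $\mathcal{G}$, vertex set $G$ and alphabet $\mathfrak{A}$, and let $X$ be an infinite computable subset of $G$. Then: (i) there is at most one function $\zeta\colon\mathfrak{A}^{<X}\to\mathfrak{A}^{X}$ that is $\langle\mathcal{G},X\rangle$-computable via $\mathfrak{M}$; (ii) any such $\zeta$ is Turing equivalent to $\{\mathfrak{M}\}$.
   Context: Notation. $\mathfrak{P}_{<\omega}(Y)$ denotes the set of finite subsets of $Y$. For a tuple-valued function $f$, $f_{[k]}$ denotes its $k$-th coordinate. Computable sets are computable subsets of $\mathbb{N}$, or of finite disjoint unions of finite sets and copies of $\mathbb{N}^k$, coded by standard computable bijections. Colored graphs. A colored graph is $\mathcal{G}=(G,(L,V),(C,E),\gamma)$ with vertex set $G$, label set $L$, labeling $V\colon G\to L$, color set $C$, edge coloring $E\colon G\times G\to\mathfrak{P}_{<\omega}(C)$, and $\gamma\colon L\to\mathfrak{P}_{<\omega}(C)$ with $E(v,w)\subseteq\gamma(V(v))\cap\gamma(V(w))$. It is computable if $G,L,C$ are computable sets and $V,E,\gamma$ are computable. Graph machines. A graph machine is $\mathfrak{M}=(\mathcal{G},(\mathfrak{A},\{0,1\}),(S,s,\alpha),T)$ with: - a finite alphabet $\mathfrak{A}\ni0,1$; - a countable state set $S$; - a state assignment $\alpha\colon L\to\mathfrak{P}_{<\omega}(S)$; - an initial state $s\in\alpha(\ell)$ for all $\ell$; - a lookup table $T\colon L\times\mathfrak{P}_{<\omega}(C)\times\mathfrak{A}\times S\to\mathfrak{P}_{<\omega}(C)\times\mathfrak{A}\times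 S$. The lookup table satisfies three conditions: - $T(\ell,c,z,t)=(c,z,t)$ if $c\not\subseteq\gamma(\ell)$ or $t\notin\alpha(\ell)$; - when $c\subseteq\gamma(\ell)$ and $t\in\alpha(\ell)$, $T_{[1]}(\ell,c,z,t)\subseteq\gamma(\ell)$ and $T_{[3]}(\ell,c,z,t)\in\alpha(\ell)$; - $T(\ell,\emptyset,0,s)=(\emptyset,0,s)$. The machine is computable if $\mathcal{G}$ is computable, $S$ is computable, and $\alpha,T$ are computable. Runs. A valid configuration is $f\colon G\to\mathfrak{P}_{<\omega}(C)\times\mathfrak{A}\times S$ with $f_{[1]}(v)\subseteq\gamma(V(v))$ and $f_{[3]}(v)\in\alpha(V(v))$. The run is given by $\langle\mathfrak{M},f\rangle(v,0)=f(v)$ and $\langle\mathfrak{M},f\rangle(v,n+1)=T(V(v),X',z,t)$, where $z,t$ are the 2nd and 3rd coordinates at stage $n$ and $X'=\bigcup_w(E(w,v)\cap\langle\mathfrak{M},f\rangle_{[1]}(w,n))$. It halts at stage $n$ if the stage-$n$ and stage-$(n+1)$ configurations coincide. The function $\{\mathfrak{M}\}$. $\mathfrak{A}^{<Y}$ denotes the set of maps $Y\to\mathfrak{A}$ with finitely many nonzero values. For $x\in\mathfrak{A}^{<G}$, $\hat{x}(v)=(\emptyset,x(v),s)$. $\{\mathfrak{M}\}\colon\mathfrak{A}^{<G}\to\mathfrak{A}^G$ is undefined at $x$ if the run on $\hat{x}$ never halts; otherwise it maps $v$ to its displayed symbol at the least halting stage. $\langle\mathcal{G},X\rangle$-computability.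 $\zeta\colon\mathfrak{A}^{<X}\to\mathfrak{A}^X$ is $\langle\mathcal{G},X\rangle$-computable via $\mathfrak{M}$ if: - (a) $\{\mathfrak{M}\}$ is total; - (b) for $x,y\in\mathfrak{A}^{<G}$, $x|_X=y|_X$ implies $\{\mathfrak{M}\}(x)=\{\mathfrak{M}\}(y)$; - (c) $\{\mathfrak{M}\}(x)(v)=0$ for all $x$ and all $v\in G\setminus X$; - (d) $\{\mathfrak{M}\}(x)|_X=\zeta(x|_X)$ for all $x$. Turing degrees of these functions refer to the maps $(x,v)\mapsto$ value, with finitely supported $x$ coded as finite objects. -}

module Defs where

open import Data.Nat using (ℕ; zero; suc; _≤_; _<_; ⌊_/2⌋; _/_)
open import Data.Nat.DivMod using (_mod_)
open import Data.Bool using (Bool; true; false; if_then_else_)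
open import Data.Fin using (Fin; toℕ)
open import Data.Vec using (Vec; []; _∷_; lookup; tabulate)
open import Data.Product using (Σ; _×_; _,_; proj₁; proj₂)
open import Data.Sum using (_⊎_)
open import Data.Unit using (⊤)
open import Relation.Nullary using (¬_)
open import Relation.Binary.PropositionalEquality using (_≡_)

data PR : ℕ → Set where
  zro  : {n : ℕ} → PR n
  scc  : PR 1
  prj  : {n : ℕ} → Fin n → PR n
  orc  : PR 2
  comp : {m n : ℕ} → PR m → (Fin m → PR n) → PR n
  rec  : {n : ℕ} → PR n → PR (suc (suc n)) → PR (suc n)
  mu   : {n : ℕ} → PR (suc n) → PR n

data Eval (O : ℕ → ℕ → ℕ) : {n : ℕ} → PR n → Vec ℕ n → ℕ → Set where
  ev-zro  : {n : ℕ} {xs : Vec ℕ n} → Eval O zro xs 0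
  ev-scc  : {x : ℕ} → Eval O scc (x ∷ []) (suc x)
  ev-prj  : {n : ℕ} {i : Fin n} {xs : Vec ℕ n} → Eval O (prj i) xs (lookup xs i)
  ev-orc  : {a b : ℕ} → Eval O orc (a ∷ b ∷ []) (O a b)
  ev-comp : {m n : ℕ} {f : PR m} {gs : Fin m → PR n} {xs : Vec ℕ n} {y : ℕ}
            (ys : Fin m → ℕ) → ((i : Fin m) → Eval O (gs i) xs (ys i)) →
            Eval O f (tabulate ys) y → Eval O (comp f gs) xs y
  ev-rec0 : {n : ℕ} {g : PR n} {h : PR (suc (suc n))} {xs : Vec ℕ n} {y : ℕ} →
            Eval O g xs y → Eval O (rec g h) (0 ∷ xs) y
  ev-recS : {n : ℕ} {g : PR n} {h : PR (suc (suc n))} {xs : Vec ℕ n} {m r y : ℕ} →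
            Eval O (rec g h) (m ∷ xs) r → Eval O h (m ∷ r ∷ xs) y →
            Eval O (rec g h) (suc m ∷ xs) y
  ev-mu   : {n : ℕ} {f : PR (suc n)} {xs : Vec ℕ n} {k : ℕ} →
            Eval O f (k ∷ xs) 0 →
            ((i : ℕ) → i < k → Σ ℕ λ m → Eval O f (i ∷ xs) (suc m)) →
            Eval O (mu f) xs k

noOracle : ℕ → ℕ → ℕ
noOracle _ _ = 0

CompOn : (n : ℕ) → (Vec ℕ n → Set) → (Vec ℕ n → ℕ) → Set
CompOn n D f = Σ (PR n) λ e → (xs : Vec ℕ n) → D xs → Eval noOracle e xs (f xs)

Computable : (n : ℕ) → (Vec ℕ n → ℕ) → Set
Computable n f = CompOn n (λ _ → ⊤) f

_≤T_ : (ℕ → ℕ → ℕ) → (ℕ → ℕ → ℕ) → Set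
F ≤T H = Σ (PR 2) λ e → (a b : ℕ) → Eval H e (a ∷ b ∷ []) (F a b)

bool→ℕ : Bool → ℕ
bool→ℕ false = 0
bool→ℕ true  = 1

ComputableSet : (ℕ → Bool) → Set
ComputableSet P = Computable 1 (λ { (v ∷ []) → bool→ℕ (P v) })

Infinite : (ℕ → Bool) → Set
Infinite P = (n : ℕ) → Σ ℕ λ m → n ≤ m × P m ≡ true

lsb : ℕ → Bool
lsb zero = false
lsb (suc zero) = true
lsb (suc (suc n)) = lsb n

testBit : ℕ → ℕ → Bool
testBit c zero = lsb c
testBit c (suc i) = testBit ⌊ c /2⌋ i

-- finite subsets of ℕ coded canonically: c codes { i | bit i of c is 1 }
_∈fs_ : ℕ → ℕ → Set
i ∈fs c = testBit c i ≡ true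

_⊆fs_ : ℕ → ℕ → Set
c ⊆fs d = (i : ℕ) → i ∈fs c → i ∈fs d

FinSubOf : (ℕ → Bool) → ℕ → Set
FinSubOf P c = (i : ℕ) → i ∈fs c → P i ≡ true

∅fs : ℕ
∅fs = 0

record ColoredGraph : Set where
  field
    G L C : ℕ → Bool
    V     : ℕ → ℕ
    E     : ℕ → ℕ → ℕ
    γ     : ℕ → ℕ
    V-in  : (v : ℕ) → G v ≡ true → L (V v) ≡ true
    γ-in  : (ℓ : ℕ) → L ℓ ≡ true → FinSubOf C (γ ℓ)
    E-in  : (v w : ℕ) → G v ≡ true → G w ≡ true → FinSubOf C (E v w)
    E-γ₁  : (v w : ℕ) → G v ≡ true → G w ≡ true → E v w ⊆fs γ (V v)
    E-γ₂  : (v w : ℕ) → G v ≡ true → G w ≡ true → E v w ⊆fs γ (V w)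

ComputableGraph : ColoredGraph → Set
ComputableGraph 𝒢 =
  ComputableSet G × ComputableSet L × ComputableSet C ×
  CompOn 1 (λ { (v ∷ []) → G v ≡ true }) (λ { (v ∷ []) → V v }) ×
  CompOn 2 (λ { (v ∷ w ∷ []) → G v ≡ true × G w ≡ true }) (λ { (v ∷ w ∷ []) → E v w }) ×
  CompOn 1 (λ { (ℓ ∷ []) → L ℓ ≡ true }) (λ { (ℓ ∷ []) → γ ℓ })
  where open ColoredGraph 𝒢

-- Graph machines; the alphabet is Fin (2 + k), with 0 = zero, 1 = suc zero

Sym : ℕ → Set
Sym k = Fin (suc (suc k))

0ₛ : {k : ℕ} → Sym k
0ₛ = Fin.zero
  where import Data.Fin as Fin

Cfg : ℕ → Set
Cfg k = ℕ × Sym k × ℕ   -- (color-set code, displayed symbol, state)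

record GraphMachine (k : ℕ) : Set where
  field
    graph : ColoredGraph
  open ColoredGraph graph public
  field
    S     : ℕ → Bool
    α     : ℕ → ℕ
    s     : ℕ
    T     : ℕ → ℕ → Sym k → ℕ → Cfg k
    α-in  : (ℓ : ℕ) → L ℓ ≡ true → FinSubOf S (α ℓ)
    s-in  : S s ≡ true
    s∈α   : (ℓ : ℕ) → L ℓ ≡ true → s ∈fs α ℓ
    T-id  : (ℓ c : ℕ) (z : Sym k) (t : ℕ) → L ℓ ≡ true → FinSubOf C c → S t ≡ true →
            (¬ (c ⊆fs γ ℓ) ⊎ ¬ (t ∈fs α ℓ)) → T ℓ c z t ≡ (c , z , t)
    T-ok  : (ℓ c : ℕ) (z : Sym k) (t : ℕ) → L ℓ ≡ true → FinSubOf C c → S t ≡ true →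
            c ⊆fs γ ℓ → t ∈fs α ℓ →
            (proj₁ (T ℓ c z t) ⊆fs γ ℓ) × (proj₂ (proj₂ (T ℓ c z t)) ∈fs α ℓ)
    T-init : (ℓ : ℕ) → L ℓ ≡ true → T ℓ ∅fs 0ₛ s ≡ (∅fs , 0ₛ , s)

-- decoding a natural number as a symbol (only used on z < 2 + k)
toSym : {k : ℕ} → ℕ → Sym k
toSym {k} z = z mod (suc (suc k))

ComputableMachine : {k : ℕ} → GraphMachine k → Set
ComputableMachine {k} 𝔐 =
  ComputableGraph graph × ComputableSet S ×
  CompOn 1 (λ { (ℓ ∷ []) → L ℓ ≡ true }) (λ { (ℓ ∷ []) → α ℓ }) ×
  CompOn 4 Dom (λ { (ℓ ∷ c ∷ z ∷ t ∷ []) → proj₁ (T ℓ c (toSym z) t) }) ×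
  CompOn 4 Dom (λ { (ℓ ∷ c ∷ z ∷ t ∷ []) → toℕ (proj₁ (proj₂ (T ℓ c (toSym z) t))) }) ×
  CompOn 4 Dom (λ { (ℓ ∷ c ∷ z ∷ t ∷ []) → proj₂ (proj₂ (T ℓ c (toSym z) t)) })
  where
    open GraphMachine 𝔐
    Dom : Vec ℕ 4 → Set
    Dom (ℓ ∷ c ∷ z ∷ t ∷ []) = L ℓ ≡ true × FinSubOf C c × z < suc (suc k) × S t ≡ true

module _ {k : ℕ} (𝔐 : GraphMachine k) where
  open GraphMachine 𝔐

  -- R v n is the configuration of vertex v at stage n
  IsRun : (ℕ → Cfg k) → (ℕ → ℕ → Cfg k) → Set
  IsRun f R =
    ((v : ℕ) → G v ≡ true → R v 0 ≡ f v) ×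
    ((n v : ℕ) → G v ≡ true → Σ ℕ λ X′ →
       ((i : ℕ) → (i ∈fs X′ → Σ ℕ λ w → G w ≡ true × i ∈fs E w v × i ∈fs proj₁ (R w n)) ×
                  ((Σ ℕ λ w → G w ≡ true × i ∈fs E w v × i ∈fs proj₁ (R w n)) → i ∈fs X′)) ×
       R v (suc n) ≡ T (V v) X′ (proj₁ (proj₂ (R v n))) (proj₂ (proj₂ (R v n))))

  HaltsAt : (ℕ → ℕ → Cfg k) → ℕ → Set
  HaltsAt R n = (v : ℕ) → G v ≡ true → R v n ≡ R v (suc n)

  hat : (ℕ → Sym k) → ℕ → Cfg k
  hat x v = (∅fs , x v , s)

  -- Out x y : {𝔐}(x) is defined and equals y (on G)
  Out : (ℕ → Sym k) → (ℕ → Sym k) → Set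
  Out x y = Σ (ℕ → ℕ → Cfg k) λ R → IsRun (hat x) R × Σ ℕ λ n →
    HaltsAt R n × ((m : ℕ) → m < n → ¬ HaltsAt R m) ×
    ((v : ℕ) → G v ≡ true → y v ≡ proj₁ (proj₂ (R v n)))

FinSupp : {k : ℕ} → (ℕ → Sym k) → Set
FinSupp x = Σ ℕ λ N → (v : ℕ) → N ≤ v → x v ≡ 0ₛ

-- x ∈ 𝔄^{<Y}: finite support, contained in Y
InFin : {k : ℕ} → (ℕ → Bool) → (ℕ → Sym k) → Set
InFin Y x = FinSupp x × ((v : ℕ) → Y v ≡ false → x v ≡ 0ₛ)

restrict : {k : ℕ} → (ℕ → Bool) → (ℕ → Sym k) → ℕ → Sym k
restrict Y x v = if Y v then x v else 0ₛ

digit : {k : ℕ} → ℕ → ℕ → Sym k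
digit {k} c zero = c mod (suc (suc k))
digit {k} c (suc v) = digit {k} (c / suc (suc k)) v

decodeOn : {k : ℕ} → (ℕ → Bool) → ℕ → ℕ → Sym k
decodeOn Y c = restrict Y (digit c)

-- a function 𝔄^{<X} → 𝔄^X (respecting pointwise equality of arguments)
record FinMap (k : ℕ) : Set where
  field
    ap  : (ℕ → Sym k) → ℕ → Sym k
    ext : (x y : ℕ → Sym k) → ((v : ℕ) → x v ≡ y v) → (v : ℕ) → ap x v ≡ ap y v
open FinMap public

GXComputableVia : {k : ℕ} (𝔐 : GraphMachine k) (X : ℕ → Bool) → FinMap k → Set
GXComputableVia {k} 𝔐 X ζ =
  -- (a)
  ((x : ℕ → Sym k) → InFin G x → Σ (ℕ → Sym k) (Out 𝔐 x)) ×
  -- (b)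
  ((x y : ℕ → Sym k) → InFin G x → InFin G y → ((v : ℕ) → X v ≡ true → x v ≡ y v) →
     (ox oy : ℕ → Sym k) → Out 𝔐 x ox → Out 𝔐 y oy → (v : ℕ) → G v ≡ true → ox v ≡ oy v) ×
  -- (c)
  ((x : ℕ → Sym k) → InFin G x → (o : ℕ → Sym k) → Out 𝔐 x o →
     (v : ℕ) → G v ≡ true → X v ≡ false → o v ≡ 0ₛ) ×
  -- (d)
  ((x : ℕ → Sym k) → InFin G x → (o : ℕ → Sym k) → Out 𝔐 x o →
     (v : ℕ) → X v ≡ true → o v ≡ ap ζ (restrict X x) v)
  where open GraphMachine 𝔐

codedMap : {k : ℕ} → (ℕ → Bool) → FinMap k → ℕ → ℕ → ℕ
codedMap X ζ c v = if X v then toℕ (ap ζ (decodeOn X c) v) else 0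

-- H is the coded version of {𝔐} (on codes of x ∈ 𝔄^{<G}, v ∈ G; 0 off G)
RepresentsM : {k : ℕ} → GraphMachine k → (ℕ → ℕ → ℕ) → Set
RepresentsM {k} 𝔐 H = (c v : ℕ) → Σ (ℕ → Sym k) λ y →
  Out 𝔐 (decodeOn G c) y × H c v ≡ (if G v then toℕ (y v) else 0)
  where open GraphMachine 𝔐

-- The whole argument rests on condition (d): on X the output of the machine
-- is ζ applied to the restriction of the input.  For an input x ∈ 𝔄^{<X}
-- (hence x ∈ 𝔄^{<G}) restricting to X changes nothing, so ζ(x)(v) is the
-- displayed symbol of {𝔐}(x) at v; as totality (a) provides this output,
-- two such ζ agree on X, which is (i).
-- For (ii) we compare the coded functions.  A code c decodes to a finitely
-- supported map (its base-(2+k) digits vanish beyond position c), and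
-- restricting the G-decoding of c to X is the X-decoding of c.  Hence on
-- v ∈ X the representation H of {𝔐} equals codedMap X ζ by (d), and off X
-- both are 0 (by (c) on G ∖ X, by definition off G).  Pointwise equal
-- functions are Turing reducible to each other by a single oracle query.
module Submission where

open import Defs
open import Data.Nat using (ℕ)
open import Data.Bool using (Bool; true)
open import Data.Product using (_×_)
open import Relation.Binary.PropositionalEquality using (_≡_)

open import Data.Nat using (zero; suc; _≤_; z≤n; s≤s; _/_)
open import Data.Nat.Properties using (≤-pred; <-≤-trans)
open import Data.Nat.DivMod using (m/n<m)
open import Data.Bool using (false)
open import Data.Fin using (toℕ)
open import Data.Vec using (_∷_; [])
open import Data.Product using (Σ; _,_; proj₁; proj₂)
open import Relation.Binary.PropositionalEquality using (refl; sym; trans; cong; subst)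
open Relation.Binary.PropositionalEquality.≡-Reasoning

_⊆_ : (ℕ → Bool) → (ℕ → Bool) → Set
X ⊆ Y = (v : ℕ) → X v ≡ true → Y v ≡ true

-- Pointwise equal functions are Turing reducible to each other:
-- the program asks the oracle for its own input.
≡⇒≤T : (F H : ℕ → ℕ → ℕ) → ((a b : ℕ) → F a b ≡ H a b) → F ≤T H
≡⇒≤T F H F≡H = orc , λ a b → subst (Eval H orc (a ∷ b ∷ [])) (sym (F≡H a b)) ev-orc

digit-zero : {k : ℕ} (v : ℕ) → digit {k} 0 v ≡ 0ₛ
digit-zero zero    = refl
digit-zero (suc v) = digit-zero v

-- The digits of c at positions v ≥ c vanish, since c / (2+k) < c for c > 0.
digit-vanishes : {k : ℕ} (c v : ℕ) → c ≤ v → digit {k} c v ≡ 0ₛ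
digit-vanishes zero    v       _         = digit-zero v
digit-vanishes {k} (suc c) (suc v) (s≤s c≤v) =
  digit-vanishes {k} (suc c / suc (suc k)) v
    (≤-pred (<-≤-trans (m/n<m (suc c) (suc (suc k)) (s≤s (s≤s z≤n))) (s≤s c≤v)))

decodeOn-finite : {k : ℕ} (Y : ℕ → Bool) (c : ℕ) → InFin Y (decodeOn {k} Y c)
decodeOn-finite {k} Y c = (c , beyond) , off
  where
  beyond : (v : ℕ) → c ≤ v → decodeOn {k} Y c v ≡ 0ₛ
  beyond v c≤v with Y v
  ... | true  = digit-vanishes c v c≤v
  ... | false = refl
  off : (v : ℕ) → Y v ≡ false → decodeOn {k} Y c v ≡ 0ₛ
  off v Yv≡false rewrite Yv≡false = refl

InFin-mono : {k : ℕ} {X Y : ℕ → Bool} → X ⊆ Y → (x : ℕ → Sym k) → InFin X x → InFin Y x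
InFin-mono {X = X} {Y} X⊆Y x (finite , offX) = finite , offY
  where
  offY : (v : ℕ) → Y v ≡ false → x v ≡ 0ₛ
  offY v Yv≡false with X v in Xv
  ... | false = offX v Xv
  ... | true with trans (sym (X⊆Y v Xv)) Yv≡false
  ... | ()

restrict-id : {k : ℕ} (X : ℕ → Bool) (x : ℕ → Sym k) → InFin X x →
  (v : ℕ) → restrict X x v ≡ x v
restrict-id X x (_ , offX) v with X v in Xv
... | true  = refl
... | false = sym (offX v Xv)

restrict-decodeOn : {k : ℕ} {X G : ℕ → Bool} → X ⊆ G →
  (c v : ℕ) → restrict X (decodeOn {k} G c) v ≡ decodeOn {k} X c v
restrict-decodeOn {X = X} X⊆G c v with X v in Xv
... | false = refl
... | true rewrite X⊆G v Xv = refl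

module _ {k : ℕ} (𝔐 : GraphMachine k) (X : ℕ → Bool) where
  open GraphMachine 𝔐 using (G)

  via-output : (ζ : FinMap k) → GXComputableVia 𝔐 X ζ → X ⊆ G →
    (x : ℕ → Sym k) → InFin X x → (o : ℕ → Sym k) → Out 𝔐 x o →
    (v : ℕ) → X v ≡ true → ap ζ x v ≡ o v
  via-output ζ (_ , _ , _ , d) X⊆G x x∈𝔄<X o out v Xv = begin
    ap ζ x v              ≡⟨ ext ζ x (restrict X x) (λ w → sym (restrict-id X x x∈𝔄<X w)) v ⟩
    ap ζ (restrict X x) v ≡⟨ sym (d x (InFin-mono X⊆G x x∈𝔄<X) o out v Xv) ⟩
    o v                   ∎

  -- On codes, any representation H of {𝔐} coincides with the coded ζ:
  -- by (d) on X, by (c) on G ∖ X, and both are 0 off G.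
  represents-codedMap : (ζ : FinMap k) → GXComputableVia 𝔐 X ζ → X ⊆ G →
    (H : ℕ → ℕ → ℕ) → RepresentsM 𝔐 H → (c v : ℕ) → H c v ≡ codedMap X ζ c v
  represents-codedMap ζ (_ , _ , vanish , d) X⊆G H rep c v with rep c v
  ... | y , out , H≡y with X v in Xv
  ... | true rewrite X⊆G v Xv = trans H≡y (cong toℕ (begin
        y v                   ≡⟨ d x x∈𝔄<G y out v Xv ⟩
        ap ζ (restrict X x) v ≡⟨ ext ζ _ _ (restrict-decodeOn X⊆G c) v ⟩
        ap ζ (decodeOn X c) v ∎))
    where
    x : ℕ → Sym k
    x = decodeOn G c
    x∈𝔄<G : InFin G x
    x∈𝔄<G = decodeOn-finite G c
  ... | false with G v in Gv
  ... | false = H≡y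
  ... | true  = trans H≡y
                  (cong toℕ (vanish (decodeOn G c) (decodeOn-finite G c) y out v Gv Xv))

mainTheorem12 : (k : ℕ) (𝔐 : GraphMachine k) → ComputableMachine 𝔐 →
    (X : ℕ → Bool) → ComputableSet X → Infinite X →
    ((v : ℕ) → X v ≡ true → GraphMachine.G 𝔐 v ≡ true) →
    ((ζ ζ′ : FinMap k) → GXComputableVia 𝔐 X ζ → GXComputableVia 𝔐 X ζ′ →
    (x : ℕ → Sym k) → InFin X x → (v : ℕ) → X v ≡ true → ap ζ x v ≡ ap ζ′ x v) ×
    ((ζ : FinMap k) → GXComputableVia 𝔐 X ζ → (H : ℕ → ℕ → ℕ) → RepresentsM 𝔐 H →
    (codedMap X ζ ≤T H) × (H ≤T codedMap X ζ))
mainTheorem12 k 𝔐 _ X _ _ X⊆G = uniqueness , equivalence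
  where
  open GraphMachine 𝔐 using (G)
  uniqueness : (ζ ζ′ : FinMap k) → GXComputableVia 𝔐 X ζ → GXComputableVia 𝔐 X ζ′ →
    (x : ℕ → Sym k) → InFin X x → (v : ℕ) → X v ≡ true → ap ζ x v ≡ ap ζ′ x v
  uniqueness ζ ζ′ ζ-via ζ′-via@(total , _) x x∈𝔄<X v Xv =
    let (o , out) = total x (InFin-mono X⊆G x x∈𝔄<X)
    in trans (via-output 𝔐 X ζ ζ-via X⊆G x x∈𝔄<X o out v Xv)
             (sym (via-output 𝔐 X ζ′ ζ′-via X⊆G x x∈𝔄<X o out v Xv))
  equivalence : (ζ : FinMap k) → GXComputableVia 𝔐 X ζ → (H : ℕ → ℕ → ℕ) → RepresentsM 𝔐 H →
    (codedMap X ζ ≤T H) × (H ≤T codedMap X ζ)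
  equivalence ζ ζ-via H rep =
    ≡⇒≤T (codedMap X ζ) H (λ c v → sym (H≡ζ c v)) , ≡⇒≤T H (codedMap X ζ) H≡ζ
    where
    H≡ζ : (c v : ℕ) → H c v ≡ codedMap X ζ c v
    H≡ζ = represents-codedMap 𝔐 X ζ ζ-via X⊆G H rep
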